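{- The maps $\Psi,\Phi:\mathfrak{S}_n\to\mathfrak{S}_n$ are inverses of each other. Moreover, for every $\pi\in\mathfrak{S}_n$, $\operatorname{Odd}(\pi)=\operatorname{Redge}(\Psi(\pi))$ and $\operatorname{Redge}(\pi)=\operatorname{Odd}(\Phi(\pi))$.
   Context: The decreasing binary tree of a word $w$ with distinct letters from $\{1,2,\ldots\}$: the empty word gives the empty tree; otherwise $w=LmR$ with $m$ the greatest letter, and the tree has root $m$, left subtree the tree of $L$ and right subtree the tree of $R$. For $x\in[n]$ let $\pi=w_1w_2xw_4w_5$ where $w_2$ (resp. $w_4$) is the maximal contiguous subword immediately left (resp. right) of $x$ all of whose letters are smaller than $x$, and $\varphi_x(\pi)=w_1w_4xw_2w_5$ (equivalently, exchange the left and right subtrees of $x$ in the decreasing binary tree); the $\varphi_x$ are commuting involutions. For $\pi\in\mathfrak{S}_n$ and $x\in[n]$ let $r_\pi(x)$ be the number of right edges (edges from a vertex to its right child) on the path from the root to $x$ in the decreasing binary tree of $\pi$; $\operatorname{Odd}(\pi)=\{x\in[n]:r_\pi(x)\text{ odd}\}$, and $\operatorname{Redge}(\pi)$ is the set of vertices that are right children of their parent. Define $\Psi(\pi)=\prod_{x\in\operatorname{Odd}(\pi)}\varphi_x(\pi)$ and $\Phi(\pi)=\prod_{x\in\operatorname{Redge}(\pi)}\varphi_x(\pi)$. -}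

module Defs where

open import Data.Nat using (ℕ; zero; suc; _<?_; _≟_; _⊔_)
open import Data.Bool using (Bool; true; false; not; if_then_else_)
open import Data.Product using (_×_; _,_)
open import Data.List using (List; []; _∷_; _++_; length; foldl; map; reverse; takeWhile; dropWhile; upTo)
open import Relation.Nullary using (Dec; yes; no)

-- Words are lists of natural numbers (letters from {1,2,...}).

data Tree : Set where
  leaf : Tree
  node : Tree → ℕ → Tree → Tree

-- greatest letter of a word (0 for the empty word; letters are ≥ 1)
maxL : List ℕ → ℕ
maxL []      = 0
maxL (a ∷ w) = a ⊔ maxL w

-- splitOn m w = (L , R) where w = L m R with this m the first occurrence of m
-- (if m does not occur: (w , []))
splitOn : ℕ → List ℕ → List ℕ × List ℕ
splitOn m [] = [] , []
splitOn m (a ∷ w) with a ≟ m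
... | yes _ = [] , w
... | no  _ with splitOn m w
...   | (L , R) = (a ∷ L) , R

-- Decreasing binary tree, computed with fuel (fuel ≥ length of the word
-- suffices, since L and R are strictly shorter than w = L m R).
dbtF : ℕ → List ℕ → Tree
dbtF zero    w  = leaf
dbtF (suc k) [] = leaf
dbtF (suc k) w@(_ ∷ _) with splitOn (maxL w) w
... | (L , R) = node (dbtF k L) (maxL w) (dbtF k R)

dbt : List ℕ → Tree
dbt w = dbtF (length w) w

-- vertices x whose number r(x) of right edges on the root-to-x path is odd
-- (argument: parity of r at the current vertex, true = odd)
oddT : Bool → Tree → List ℕ
oddT p leaf         = []
oddT p (node l m r) = (if p then m ∷ [] else []) ++ oddT p l ++ oddT (not p) r

-- vertices that are right children of their parent
-- (argument: whether the current vertex is a right child)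
redgeT : Bool → Tree → List ℕ
redgeT b leaf         = []
redgeT b (node l m r) = (if b then m ∷ [] else []) ++ redgeT false l ++ redgeT true r

Odd : List ℕ → List ℕ
Odd π = oddT false (dbt π)

Redge : List ℕ → List ℕ
Redge π = redgeT false (dbt π)

-- φ_x : w1 w2 x w4 w5 ↦ w1 w4 x w2 w5, where w2 (resp. w4) is the maximal
-- contiguous subword immediately left (resp. right) of x with all letters < x.
φ : ℕ → List ℕ → List ℕ
φ x π with splitOn x π
... | (pre , post) =
  let rpre = reverse pre
      w2   = reverse (takeWhile (_<? x) rpre)
      w1   = reverse (dropWhile (_<? x) rpre)
      w4   = takeWhile (_<? x) post
      w5   = dropWhile (_<? x) post
  in w1 ++ w4 ++ x ∷ w2 ++ w5

-- apply φ_x successively for all x in a list (the φ_x commute, so the order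
-- is irrelevant by the paper; we use the order of the list)
φs : List ℕ → List ℕ → List ℕ
φs xs π = foldl (λ w x → φ x w) π xs

Ψ : List ℕ → List ℕ
Ψ π = φs (Odd π) π

Φ : List ℕ → List ℕ
Φ π = φs (Redge π) π

oneTo : ℕ → List ℕ
oneTo n = map suc (upTo n)

{-# OPTIONS --safe #-}
module Submission where

-- A permutation is the inorder reading of its decreasing binary tree, and there the two
-- subtrees of x are read as the maximal windows w₂, w₄ of letters smaller than x on either
-- side of x; so φ_x exchanges the subtrees of x.  The exchanges commute and are involutions,
-- hence Ψ and Φ exchange the subtrees exactly at the vertices of odd right-depth, resp. at the
-- right children.  After exchanging at the odd vertices, a child of v is a right child iff it
-- was a left child with r(v) odd or a right child with r(v) even, i.e. iff its own r is odd:
-- Redge (Ψ π) = Odd π, so Φ (Ψ π) exchanges once more at the same vertices and gives back π.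

open import Data.Bool using (Bool; true; false; not; _xor_; if_then_else_)
open import Data.Bool.Properties using (xor-assoc; xor-identityʳ)
open import Data.Empty using (⊥-elim)
open import Data.List using (List; []; _∷_; _++_; length; reverse; takeWhile; dropWhile)
open import Data.List.Properties
  using (++-assoc; ++-identityʳ; ++-conicalʳ; unfold-reverse; reverse-++; reverse-involutive;
         length-++-sucʳ; length-++-≤ˡ; length-++-≤ʳ)
open import Data.List.Membership.Propositional using (_∈_; _∉_)
open import Data.List.Membership.Propositional.Properties using (∈-++⁺ˡ; ∈-++⁺ʳ; ∈-++⁻; ∈-∃++)
open import Data.List.Relation.Binary.Disjoint.Propositional using (Disjoint)
open import Data.List.Relation.Binary.Permutation.Propositional
  using (_↭_; ↭-refl; ↭-sym; ↭-trans; ↭-reflexive; ↭-prep; ↭⇒↭ₛ; module PermutationReasoning)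
open import Data.List.Relation.Binary.Permutation.Propositional.Properties
  using (All-resp-↭; ∈-resp-↭; ++⁺; ++-comm; shift; ↭-reverse)
open import Data.List.Relation.Unary.All as All using (All; []; _∷_)
import Data.List.Relation.Unary.All.Properties as All
open import Data.List.Relation.Unary.Any using (here; there)
open import Data.List.Relation.Unary.Unique.Propositional using (Unique; []; _∷_)
import Data.List.Relation.Unary.Unique.Propositional.Properties as Unique
open import Data.Nat using (ℕ; zero; suc; _≤_; _<_; _<?_; _<ᵇ_; _≟_; _≡ᵇ_; z≤n; s≤s)
open import Data.Nat.Properties
  using (≤-refl; ≤-trans; ≤-total; ≤-antisym; <⇒≤; <⇒≱; <-irrefl; ≤∧≢⇒<; suc-injective;
         ⊔-lub; m≤m⊔n; m≤n⊔m; m≤n⇒m⊔n≡n; m≥n⇒m⊔n≡m; ⊔-identityʳ)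
open import Data.Product using (_×_; ∃-syntax; _,_; proj₁; proj₂)
open import Data.Sum using (_⊎_; inj₁; inj₂)
open import Data.Unit using (⊤)
open import Function using (id; const; _∘_)
open import Function.Bundles using (_⇔_; mk⇔)
open import Relation.Binary.PropositionalEquality
  using (_≡_; _≢_; refl; sym; trans; cong; cong₂; subst; setoid; module ≡-Reasoning)
open import Relation.Nullary using (yes; no)
open import Relation.Nullary.Decidable using (dec-true; dec-false)

open import Data.List.Relation.Binary.Permutation.Setoid.Properties (setoid ℕ) using (Unique-resp-↭)

open import Defs

-- Words

Unique-++⁻ : ∀ {xs ys : List ℕ} → Unique (xs ++ ys) → Unique xs × Unique ys × Disjoint xs ys
Unique-++⁻ {[]}     u         = [] , u , λ ()
Unique-++⁻ {x ∷ xs} (x∉ ∷ u) with Unique-++⁻ {xs} u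
... | uxs , uys , xs#ys =
  All.++⁻ˡ xs x∉ ∷ uxs , uys ,
  λ { (here refl , y∈ys) → All.lookup (All.++⁻ʳ xs x∉) y∈ys refl
    ; (there v∈xs , v∈ys) → xs#ys (v∈xs , v∈ys) }

All<⇒∉ : ∀ {x} {xs : List ℕ} → All (_< x) xs → x ∉ xs
All<⇒∉ xs<x x∈xs = <-irrefl refl (All.lookup xs<x x∈xs)

All≤∧∉⇒All< : ∀ {x} {xs : List ℕ} → All (_≤ x) xs → x ∉ xs → All (_< x) xs
All≤∧∉⇒All< []         _   = []
All≤∧∉⇒All< (y≤x ∷ ys) x∉ =
  ≤∧≢⇒< y≤x (λ y≡x → x∉ (here (sym y≡x))) ∷ All≤∧∉⇒All< ys (x∉ ∘ there)

∉-++⁺ : ∀ {x} xs {ys : List ℕ} → x ∉ xs → x ∉ ys → x ∉ xs ++ ys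
∉-++⁺ xs x∉xs x∉ys x∈ with ∈-++⁻ xs x∈
... | inj₁ x∈xs = x∉xs x∈xs
... | inj₂ x∈ys = x∉ys x∈ys

++-∷≢[] : ∀ (xs : List ℕ) {y ys} → xs ++ y ∷ ys ≢ []
++-∷≢[] xs {y} {ys} eq with () ← ++-conicalʳ xs (y ∷ ys) eq

≡ᵇ-refl : ∀ x → (x ≡ᵇ x) ≡ true
≡ᵇ-refl x = dec-true (x ≟ x) refl

≢⇒≡ᵇ-false : ∀ {x y} → x ≢ y → (x ≡ᵇ y) ≡ false
≢⇒≡ᵇ-false {x} {y} = dec-false (x ≟ y)

++-assoc-window : ∀ (a b : List ℕ) x c d e → (a ++ b ++ x ∷ c ++ d) ++ e ≡ a ++ b ++ x ∷ c ++ d ++ e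
++-assoc-window a b x c d e
  rewrite ++-assoc a (b ++ x ∷ c ++ d) e | ++-assoc b (x ∷ c ++ d) e | ++-assoc c d e = refl

reverse-++-∷ : ∀ (xs : List ℕ) m ys → reverse (xs ++ m ∷ ys) ≡ reverse ys ++ m ∷ reverse xs
reverse-++-∷ xs m ys
  rewrite reverse-++ xs (m ∷ ys) | unfold-reverse m ys | ++-assoc (reverse ys) (m ∷ []) (reverse xs) = refl

StartsAtLeast : ℕ → List ℕ → Set
StartsAtLeast x []      = ⊤
StartsAtLeast x (a ∷ _) = x ≤ a

StartsAtLeast-++ : ∀ {x m} U {V} → StartsAtLeast x U → x ≤ m → StartsAtLeast x (U ++ m ∷ V)
StartsAtLeast-++ []      _    x≤m = x≤m
StartsAtLeast-++ (_ ∷ _) x≤a _   = x≤a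

module _ {x : ℕ} where

  private
    <ᵇ-true : ∀ {u} → u < x → (u <ᵇ x) ≡ true
    <ᵇ-true {u} = dec-true (u <? x)

    <ᵇ-false : ∀ {u} → x ≤ u → (u <ᵇ x) ≡ false
    <ᵇ-false {u} x≤u = dec-false (u <? x) (λ u<x → <⇒≱ u<x x≤u)

  takeWhile-<-++ : ∀ {A U} → All (_< x) A → StartsAtLeast x U → takeWhile (_<? x) (A ++ U) ≡ A
  takeWhile-<-++ {U = []}    []          _   = refl
  takeWhile-<-++ {U = _ ∷ _} []          x≤u rewrite <ᵇ-false x≤u = refl
  takeWhile-<-++ {a ∷ _}     (a<x ∷ A<x) x≤U rewrite <ᵇ-true a<x = cong (a ∷_) (takeWhile-<-++ A<x x≤U)

  dropWhile-<-++ : ∀ {A U} → All (_< x) A → StartsAtLeast x U → dropWhile (_<? x) (A ++ U) ≡ U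
  dropWhile-<-++ {U = []}    []          _   = refl
  dropWhile-<-++ {U = _ ∷ _} []          x≤u rewrite <ᵇ-false x≤u = refl
  dropWhile-<-++ {a ∷ _}     (a<x ∷ A<x) x≤U rewrite <ᵇ-true a<x = dropWhile-<-++ A<x x≤U

splitOn-++ : ∀ {x} U {V} → x ∉ U → splitOn x (U ++ x ∷ V) ≡ (U , V)
splitOn-++ {x} [] _ with x ≟ x
... | yes _   = refl
... | no  x≢x = ⊥-elim (x≢x refl)
splitOn-++ {x} (a ∷ U) {V} x∉ with a ≟ x
... | yes a≡x = ⊥-elim (x∉ (here (sym a≡x)))
... | no  _   rewrite splitOn-++ U {V} (x∉ ∘ there) = refl

φ-unfold : ∀ {x} U {V} → x ∉ U →
  φ x (U ++ x ∷ V) ≡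
    reverse (dropWhile (_<? x) (reverse U)) ++ takeWhile (_<? x) V ++ x ∷
    reverse (takeWhile (_<? x) (reverse U)) ++ dropWhile (_<? x) V
φ-unfold U {V} x∉U rewrite splitOn-++ U {V} x∉U = refl

φ-exchange : ∀ {x} w₁ {w₂ w₄ w₅} → x ∉ w₁ → All (_< x) w₂ → All (_< x) w₄ →
  StartsAtLeast x (reverse w₁) → StartsAtLeast x w₅ →
  φ x (w₁ ++ w₂ ++ x ∷ w₄ ++ w₅) ≡ w₁ ++ w₄ ++ x ∷ w₂ ++ w₅
φ-exchange {x} w₁ {w₂} {w₄} {w₅} x∉w₁ w₂<x w₄<x w₁≥x w₅≥x
  rewrite sym (++-assoc w₁ w₂ (x ∷ w₄ ++ w₅))
        | φ-unfold (w₁ ++ w₂) {w₄ ++ w₅} (∉-++⁺ w₁ x∉w₁ (All<⇒∉ w₂<x))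
        | reverse-++ w₁ w₂
        | takeWhile-<-++ (All-resp-↭ (↭-sym (↭-reverse w₂)) w₂<x) w₁≥x
        | dropWhile-<-++ (All-resp-↭ (↭-sym (↭-reverse w₂)) w₂<x) w₁≥x
        | takeWhile-<-++ w₄<x w₅≥x
        | dropWhile-<-++ w₄<x w₅≥x
        | reverse-involutive w₁
        | reverse-involutive w₂
        = refl

-- Decreasing trees and subtree exchanges

inorder : Tree → List ℕ
inorder leaf         = []
inorder (node l m r) = inorder l ++ m ∷ inorder r

data Decreasing : Tree → Set where
  leaf : Decreasing leaf
  node : ∀ {l m r} → All (_< m) (inorder l) → All (_< m) (inorder r) →
         Decreasing l → Decreasing r → Decreasing (node l m r)

DecreasingDistinct : Tree → Set
DecreasingDistinct T = Decreasing T × Unique (inorder T)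

module _ {l : Tree} {m : ℕ} {r : Tree} where

  ∈-inorderˡ : ∀ {y} → y ∈ inorder l → y ∈ inorder (node l m r)
  ∈-inorderˡ = ∈-++⁺ˡ

  ∈-inorderʳ : ∀ {y} → y ∈ inorder r → y ∈ inorder (node l m r)
  ∈-inorderʳ y∈r = ∈-++⁺ʳ (inorder l) (there y∈r)

  root-∈-inorder : m ∈ inorder (node l m r)
  root-∈-inorder = ∈-++⁺ʳ (inorder l) (here refl)

  ∈-inorder⁻ : ∀ {y} → y ∈ inorder (node l m r) → y ∈ inorder l ⊎ y ≡ m ⊎ y ∈ inorder r
  ∈-inorder⁻ y∈ with ∈-++⁻ (inorder l) y∈
  ... | inj₁ y∈l          = inj₁ y∈l
  ... | inj₂ (here y≡m)   = inj₂ (inj₁ y≡m)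
  ... | inj₂ (there y∈r)  = inj₂ (inj₂ y∈r)

  private
    split-inorder : Unique (inorder (node l m r)) →
                    Unique (inorder l) × Unique (m ∷ inorder r) × Disjoint (inorder l) (m ∷ inorder r)
    split-inorder = Unique-++⁻ {inorder l}

  DecreasingDistinct-left : DecreasingDistinct (node l m r) → DecreasingDistinct l
  DecreasingDistinct-left (node _ _ dl _ , u) = dl , proj₁ (split-inorder u)

  DecreasingDistinct-right : DecreasingDistinct (node l m r) → DecreasingDistinct r
  DecreasingDistinct-right (node _ _ _ dr , u) with _ ∷ ur ← proj₁ (proj₂ (split-inorder u)) = dr , ur

  subtrees-disjoint : DecreasingDistinct (node l m r) → ∀ {y} → y ∈ inorder l → y ∉ inorder r
  subtrees-disjoint (_ , u) y∈l y∈r = proj₂ (proj₂ (split-inorder u)) (y∈l , there y∈r)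

swapIf : Bool → Tree → ℕ → Tree → Tree
swapIf false l m r = node l m r
swapIf true  l m r = node r m l

inorder-swapIf : ∀ b l m r → inorder (swapIf b l m r) ↭ inorder (node l m r)
inorder-swapIf false l m r = ↭-refl
inorder-swapIf true  l m r =
  ↭-trans (++-comm (inorder r) (m ∷ inorder l)) (↭-sym (shift m (inorder l) (inorder r)))

Decreasing-swapIf : ∀ b {l m r} → All (_< m) (inorder l) → All (_< m) (inorder r) →
  Decreasing l → Decreasing r → Decreasing (swapIf b l m r)
Decreasing-swapIf false l<m r<m dl dr = node l<m r<m dl dr
Decreasing-swapIf true  l<m r<m dl dr = node r<m l<m dr dl

swapWhere : (ℕ → Bool) → Tree → Tree
swapWhere Q leaf         = leaf
swapWhere Q (node l m r) = swapIf (Q m) (swapWhere Q l) m (swapWhere Q r)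

swapAt : ℕ → Tree → Tree
swapAt x = swapWhere (_≡ᵇ x)

inorder-swapWhere : ∀ Q T → inorder (swapWhere Q T) ↭ inorder T
inorder-swapWhere Q leaf         = ↭-refl
inorder-swapWhere Q (node l m r) =
  ↭-trans (inorder-swapIf (Q m) _ m _) (++⁺ (inorder-swapWhere Q l) (↭-prep m (inorder-swapWhere Q r)))

Decreasing-swapWhere : ∀ Q {T} → Decreasing T → Decreasing (swapWhere Q T)
Decreasing-swapWhere Q leaf = leaf
Decreasing-swapWhere Q {node l m r} (node l<m r<m dl dr) =
  Decreasing-swapIf (Q m)
    (All-resp-↭ (↭-sym (inorder-swapWhere Q l)) l<m) (All-resp-↭ (↭-sym (inorder-swapWhere Q r)) r<m)
    (Decreasing-swapWhere Q dl) (Decreasing-swapWhere Q dr)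

DecreasingDistinct-swapWhere : ∀ Q {T} → DecreasingDistinct T → DecreasingDistinct (swapWhere Q T)
DecreasingDistinct-swapWhere Q {T} (d , u) =
  Decreasing-swapWhere Q d , Unique-resp-↭ (↭⇒↭ₛ (↭-sym (inorder-swapWhere Q T))) u

swapWhere-local : ∀ {P Q} T → (∀ {y} → y ∈ inorder T → P y ≡ Q y) → swapWhere P T ≡ swapWhere Q T
swapWhere-local leaf         _   = refl
swapWhere-local (node l m r) P≡Q
  rewrite P≡Q (root-∈-inorder {l} {m} {r})
        | swapWhere-local l (P≡Q ∘ ∈-inorderˡ {l} {m} {r})
        | swapWhere-local r (P≡Q ∘ ∈-inorderʳ {l} {m} {r})
        = refl

swapWhere-false : ∀ T → swapWhere (const false) T ≡ T
swapWhere-false leaf         = refl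
swapWhere-false (node l m r) = cong₂ (λ l′ r′ → node l′ m r′) (swapWhere-false l) (swapWhere-false r)

swapWhere-swapIf : ∀ P q l m r →
  swapWhere P (swapIf q l m r) ≡ swapIf (q xor P m) (swapWhere P l) m (swapWhere P r)
swapWhere-swapIf P false l m r = refl
swapWhere-swapIf P true  l m r with P m
... | false = refl
... | true  = refl

swapWhere-∘ : ∀ P Q T → swapWhere P (swapWhere Q T) ≡ swapWhere (λ y → Q y xor P y) T
swapWhere-∘ P Q leaf         = refl
swapWhere-∘ P Q (node l m r) =
  trans (swapWhere-swapIf P (Q m) (swapWhere Q l) m (swapWhere Q r))
        (cong₂ (λ l′ r′ → swapIf (Q m xor P m) l′ m r′) (swapWhere-∘ P Q l) (swapWhere-∘ P Q r))

swapAt-∉ : ∀ {x} T → x ∉ inorder T → swapAt x T ≡ T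
swapAt-∉ {x} T x∉T =
  trans (swapWhere-local T (λ {y} y∈T → ≢⇒≡ᵇ-false {y} {x} (λ { refl → x∉T y∈T }))) (swapWhere-false T)

-- The paper's π = w₁ w₂ x w₄ w₅, where w₂ x w₄ is the inorder reading of the subtree of x.
record Factorisation (x : ℕ) (T : Tree) : Set where
  field
    w₁ w₂ w₄ w₅   : List ℕ
    inorder≡      : inorder T ≡ w₁ ++ w₂ ++ x ∷ w₄ ++ w₅
    inorder-swap≡ : inorder (swapAt x T) ≡ w₁ ++ w₄ ++ x ∷ w₂ ++ w₅
    x∉w₁          : x ∉ w₁
    w₂<x          : All (_< x) w₂
    w₄<x          : All (_< x) w₄
    w₁-ends≥x     : StartsAtLeast x (reverse w₁)
    w₅-starts≥x   : StartsAtLeast x w₅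

factorisation-root : ∀ {l x r} → All (_< x) (inorder l) → All (_< x) (inorder r) → Factorisation x (node l x r)
factorisation-root {l} {x} {r} l<x r<x = record
  { w₁ = [] ; w₂ = inorder l ; w₄ = inorder r ; w₅ = []
  ; inorder≡      = cong (λ v → inorder l ++ x ∷ v) (sym (++-identityʳ (inorder r)))
  ; inorder-swap≡ = swapped
  ; x∉w₁ = λ () ; w₂<x = l<x ; w₄<x = r<x ; w₁-ends≥x = _ ; w₅-starts≥x = _ }
  where
  swapped : inorder (swapAt x (node l x r)) ≡ inorder r ++ x ∷ inorder l ++ []
  swapped rewrite ≡ᵇ-refl x | swapAt-∉ l (All<⇒∉ l<x) | swapAt-∉ r (All<⇒∉ r<x) | ++-identityʳ (inorder l) = refl

factorisation-left : ∀ {x l m r} → Factorisation x l → x < m → x ∉ inorder r → Factorisation x (node l m r)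
factorisation-left {x} {l} {m} {r} F x<m x∉r = record
  { w₁ = w₁ ; w₂ = w₂ ; w₄ = w₄ ; w₅ = w₅ ++ m ∷ inorder r
  ; inorder≡      = trans (cong (_++ m ∷ inorder r) inorder≡) (++-assoc-window w₁ w₂ x w₄ w₅ _)
  ; inorder-swap≡ = swapped
  ; x∉w₁ = x∉w₁ ; w₂<x = w₂<x ; w₄<x = w₄<x ; w₁-ends≥x = w₁-ends≥x
  ; w₅-starts≥x = StartsAtLeast-++ w₅ w₅-starts≥x (<⇒≤ x<m) }
  where
  open Factorisation F
  swapped : inorder (swapAt x (node l m r)) ≡ w₁ ++ w₄ ++ x ∷ w₂ ++ w₅ ++ m ∷ inorder r
  swapped rewrite ≢⇒≡ᵇ-false (λ m≡x → <-irrefl (sym m≡x) x<m) | swapAt-∉ r x∉r =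
    trans (cong (_++ m ∷ inorder r) inorder-swap≡) (++-assoc-window w₁ w₄ x w₂ w₅ _)

factorisation-right : ∀ {x l m r} → Factorisation x r → x < m → x ∉ inorder l → Factorisation x (node l m r)
factorisation-right {x} {l} {m} {r} F x<m x∉l = record
  { w₁ = inorder l ++ m ∷ w₁ ; w₂ = w₂ ; w₄ = w₄ ; w₅ = w₅
  ; inorder≡      = trans (cong (λ v → inorder l ++ m ∷ v) inorder≡) (sym (++-assoc (inorder l) (m ∷ w₁) _))
  ; inorder-swap≡ = swapped
  ; x∉w₁ = ∉-++⁺ (inorder l) x∉l λ { (here x≡m) → <-irrefl x≡m x<m ; (there x∈w₁) → x∉w₁ x∈w₁ }
  ; w₂<x = w₂<x ; w₄<x = w₄<x
  ; w₁-ends≥x = subst (StartsAtLeast x) (sym (reverse-++-∷ (inorder l) m w₁))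
                      (StartsAtLeast-++ (reverse w₁) w₁-ends≥x (<⇒≤ x<m))
  ; w₅-starts≥x = w₅-starts≥x }
  where
  open Factorisation F
  swapped : inorder (swapAt x (node l m r)) ≡ (inorder l ++ m ∷ w₁) ++ w₄ ++ x ∷ w₂ ++ w₅
  swapped rewrite ≢⇒≡ᵇ-false (λ m≡x → <-irrefl (sym m≡x) x<m) | swapAt-∉ l x∉l =
    trans (cong (λ v → inorder l ++ m ∷ v) inorder-swap≡) (sym (++-assoc (inorder l) (m ∷ w₁) _))

factorisation : ∀ {x T} → DecreasingDistinct T → x ∈ inorder T → Factorisation x T
factorisation {x} {node l m r} dd@(node l<m r<m _ _ , _) x∈T with ∈-inorder⁻ {l} {m} {r} x∈T
... | inj₁ x∈l        = factorisation-left (factorisation (DecreasingDistinct-left dd) x∈l)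
                          (All.lookup l<m x∈l) (subtrees-disjoint dd x∈l)
... | inj₂ (inj₁ refl) = factorisation-root l<m r<m
... | inj₂ (inj₂ x∈r) = factorisation-right (factorisation (DecreasingDistinct-right dd) x∈r)
                          (All.lookup r<m x∈r) (λ x∈l → subtrees-disjoint dd x∈l x∈r)

φ-inorder : ∀ {x T} → DecreasingDistinct T → x ∈ inorder T → φ x (inorder T) ≡ inorder (swapAt x T)
φ-inorder {x} {T} dd x∈T = begin
  φ x (inorder T)                   ≡⟨ cong (φ x) inorder≡ ⟩
  φ x (w₁ ++ w₂ ++ x ∷ w₄ ++ w₅)    ≡⟨ φ-exchange w₁ x∉w₁ w₂<x w₄<x w₁-ends≥x w₅-starts≥x ⟩
  w₁ ++ w₄ ++ x ∷ w₂ ++ w₅          ≡⟨ sym inorder-swap≡ ⟩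
  inorder (swapAt x T)              ∎
  where
  open ≡-Reasoning
  open Factorisation (factorisation dd x∈T)

-- Composites of the φ_x

-- The exchanges commute and are involutions, so a composite of them only sees how often
-- each vertex occurs, modulo 2.
parity : List ℕ → ℕ → Bool
parity []       y = false
parity (x ∷ xs) y = (y ≡ᵇ x) xor parity xs y

parity-++ : ∀ xs ys y → parity (xs ++ ys) y ≡ parity xs y xor parity ys y
parity-++ []       ys y = refl
parity-++ (x ∷ xs) ys y =
  trans (cong ((y ≡ᵇ x) xor_) (parity-++ xs ys y)) (sym (xor-assoc (y ≡ᵇ x) (parity xs y) (parity ys y)))

parity-∉ : ∀ {y} xs → y ∉ xs → parity xs y ≡ false
parity-∉     []       _  = refl
parity-∉ {y} (x ∷ xs) y∉ rewrite ≢⇒≡ᵇ-false {y} {x} (y∉ ∘ here) = parity-∉ xs (y∉ ∘ there)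

-- The hypothesis on xs is needed: on a word not containing x, φ x inserts a copy of x.
φs-inorder : ∀ xs {T} → DecreasingDistinct T → All (_∈ inorder T) xs →
  φs xs (inorder T) ≡ inorder (swapWhere (parity xs) T)
φs-inorder []       {T} _  _                 = cong inorder (sym (swapWhere-false T))
φs-inorder (x ∷ xs) {T} dd (x∈T ∷ xs⊆T) = begin
  φs xs (φ x (inorder T))                        ≡⟨ cong (φs xs) (φ-inorder dd x∈T) ⟩
  φs xs (inorder (swapAt x T))                   ≡⟨ φs-inorder xs (DecreasingDistinct-swapWhere _ dd) xs⊆swapAt ⟩
  inorder (swapWhere (parity xs) (swapAt x T))   ≡⟨ cong inorder (swapWhere-∘ (parity xs) (_≡ᵇ x) T) ⟩
  inorder (swapWhere (parity (x ∷ xs)) T)        ∎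
  where
  open ≡-Reasoning
  xs⊆swapAt : All (_∈ inorder (swapAt x T)) xs
  xs⊆swapAt = All.map (∈-resp-↭ (↭-sym (inorder-swapWhere _ T))) xs⊆T

-- Exchanges at positionally marked vertices

parity-root : ∀ b {m} → parity (if b then m ∷ [] else []) m ≡ b
parity-root true  {m} rewrite ≡ᵇ-refl m = refl
parity-root false     = refl

parity-root-≢ : ∀ b {m y} → y ≢ m → parity (if b then m ∷ [] else []) y ≡ false
parity-root-≢ true  {m} {y} y≢m rewrite ≢⇒≡ᵇ-false {y} {m} y≢m = refl
parity-root-≢ false         _   = refl

module Marking (toLeft toRight : Bool → Bool) where

  marked : Bool → Tree → List ℕ
  marked b leaf         = []
  marked b (node l m r) = (if b then m ∷ [] else []) ++ marked (toLeft b) l ++ marked (toRight b) r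

  swapMarked : Bool → Tree → Tree
  swapMarked b leaf         = leaf
  swapMarked b (node l m r) = swapIf b (swapMarked (toLeft b) l) m (swapMarked (toRight b) r)

  marked⊆inorder : ∀ b T {y} → y ∈ marked b T → y ∈ inorder T
  marked⊆inorder b     (node l m r) y∈ with ∈-++⁻ (if b then m ∷ [] else []) y∈
  marked⊆inorder true  (node l m r) y∈ | inj₁ (here refl) = root-∈-inorder {l} {m} {r}
  marked⊆inorder b     (node l m r) y∈ | inj₂ y∈lr with ∈-++⁻ (marked (toLeft b) l) y∈lr
  ... | inj₁ y∈l = ∈-inorderˡ {l} {m} {r} (marked⊆inorder (toLeft b) l y∈l)
  ... | inj₂ y∈r = ∈-inorderʳ {l} {m} {r} (marked⊆inorder (toRight b) r y∈r)

  parity-marked-∉ : ∀ b T {y} → y ∉ inorder T → parity (marked b T) y ≡ false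
  parity-marked-∉ b T y∉T = parity-∉ (marked b T) (y∉T ∘ marked⊆inorder b T)

  parity-marked-node : ∀ b l m r y →
    parity (marked b (node l m r)) y ≡
      parity (if b then m ∷ [] else []) y xor (parity (marked (toLeft b) l) y xor parity (marked (toRight b) r) y)
  parity-marked-node b l m r y =
    trans (parity-++ (if b then m ∷ [] else []) _ y)
          (cong (parity (if b then m ∷ [] else []) y xor_) (parity-++ (marked (toLeft b) l) _ y))

  parity-marked-root : ∀ b {l m r} → DecreasingDistinct (node l m r) → parity (marked b (node l m r)) m ≡ b
  parity-marked-root b {l} {m} {r} (node l<m r<m _ _ , _) = begin
    parity (marked b (node l m r)) m
      ≡⟨ parity-marked-node b l m r m ⟩
    parity root m xor (parity (marked (toLeft b) l) m xor parity (marked (toRight b) r) m)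
      ≡⟨ cong₂ (λ p q → parity root m xor (p xor q))
               (parity-marked-∉ (toLeft b) l (All<⇒∉ l<m)) (parity-marked-∉ (toRight b) r (All<⇒∉ r<m)) ⟩
    parity root m xor false
      ≡⟨ xor-identityʳ _ ⟩
    parity root m
      ≡⟨ parity-root b ⟩
    b ∎
    where
    open ≡-Reasoning
    root = if b then m ∷ [] else []

  parity-marked-left : ∀ b {l m r} → DecreasingDistinct (node l m r) →
    ∀ {y} → y ∈ inorder l → parity (marked b (node l m r)) y ≡ parity (marked (toLeft b) l) y
  parity-marked-left b {l} {m} {r} dd@(node l<m _ _ _ , _) {y} y∈l = begin
    parity (marked b (node l m r)) y
      ≡⟨ parity-marked-node b l m r y ⟩
    parity root y xor (parity (marked (toLeft b) l) y xor parity (marked (toRight b) r) y)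
      ≡⟨ cong₂ (λ p q → p xor (parity (marked (toLeft b) l) y xor q))
               (parity-root-≢ b (λ { refl → <-irrefl refl (All.lookup l<m y∈l) }))
               (parity-marked-∉ (toRight b) r (subtrees-disjoint dd y∈l)) ⟩
    parity (marked (toLeft b) l) y xor false
      ≡⟨ xor-identityʳ _ ⟩
    parity (marked (toLeft b) l) y ∎
    where
    open ≡-Reasoning
    root = if b then m ∷ [] else []

  parity-marked-right : ∀ b {l m r} → DecreasingDistinct (node l m r) →
    ∀ {y} → y ∈ inorder r → parity (marked b (node l m r)) y ≡ parity (marked (toRight b) r) y
  parity-marked-right b {l} {m} {r} dd@(node _ r<m _ _ , _) {y} y∈r = begin
    parity (marked b (node l m r)) y
      ≡⟨ parity-marked-node b l m r y ⟩
    parity root y xor (parity (marked (toLeft b) l) y xor parity (marked (toRight b) r) y)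
      ≡⟨ cong₂ (λ p q → p xor (q xor parity (marked (toRight b) r) y))
               (parity-root-≢ b (λ { refl → <-irrefl refl (All.lookup r<m y∈r) }))
               (parity-marked-∉ (toLeft b) l (λ y∈l → subtrees-disjoint dd y∈l y∈r)) ⟩
    parity (marked (toRight b) r) y ∎
    where
    open ≡-Reasoning
    root = if b then m ∷ [] else []

  swapWhere-parity-marked : ∀ b {T} → DecreasingDistinct T → swapWhere (parity (marked b T)) T ≡ swapMarked b T
  swapWhere-parity-marked b {leaf}       _  = refl
  swapWhere-parity-marked b {node l m r} dd = begin
    swapIf (Q m) (swapWhere Q l) m (swapWhere Q r)
      ≡⟨ cong (λ q → swapIf q (swapWhere Q l) m (swapWhere Q r)) (parity-marked-root b dd) ⟩
    swapIf b (swapWhere Q l) m (swapWhere Q r)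
      ≡⟨ cong₂ (λ l′ r′ → swapIf b l′ m r′) left right ⟩
    swapIf b (swapMarked (toLeft b) l) m (swapMarked (toRight b) r) ∎
    where
    open ≡-Reasoning
    Q = parity (marked b (node l m r))
    left : swapWhere Q l ≡ swapMarked (toLeft b) l
    left = trans (swapWhere-local l (parity-marked-left b dd))
                 (swapWhere-parity-marked (toLeft b) (DecreasingDistinct-left dd))
    right : swapWhere Q r ≡ swapMarked (toRight b) r
    right = trans (swapWhere-local r (parity-marked-right b dd))
                  (swapWhere-parity-marked (toRight b) (DecreasingDistinct-right dd))

  φs-marked : ∀ b {T} → DecreasingDistinct T → φs (marked b T) (inorder T) ≡ inorder (swapMarked b T)
  φs-marked b {T} dd =
    trans (φs-inorder (marked b T) dd (All.tabulate (marked⊆inorder b T)))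
          (cong inorder (swapWhere-parity-marked b dd))

  DecreasingDistinct-swapMarked : ∀ b {T} → DecreasingDistinct T → DecreasingDistinct (swapMarked b T)
  DecreasingDistinct-swapMarked b dd =
    subst DecreasingDistinct (swapWhere-parity-marked b dd) (DecreasingDistinct-swapWhere _ dd)

  inorder-swapMarked : ∀ b {T} → DecreasingDistinct T → inorder (swapMarked b T) ↭ inorder T
  inorder-swapMarked b {T} dd =
    subst (λ T′ → inorder T′ ↭ inorder T) (swapWhere-parity-marked b dd) (inorder-swapWhere _ T)

module OddVertices   = Marking id not
module RightChildren = Marking (const false) (const true)

swapOdd swapRedge : Bool → Tree → Tree
swapOdd   = OddVertices.swapMarked
swapRedge = RightChildren.swapMarked

oddT≡marked : ∀ p T → oddT p T ≡ OddVertices.marked p T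
oddT≡marked p leaf         = refl
oddT≡marked p (node l m r) =
  cong₂ (λ xs ys → (if p then m ∷ [] else []) ++ xs ++ ys) (oddT≡marked p l) (oddT≡marked (not p) r)

redgeT≡marked : ∀ b T → redgeT b T ≡ RightChildren.marked b T
redgeT≡marked b leaf         = refl
redgeT≡marked b (node l m r) =
  cong₂ (λ xs ys → (if b then m ∷ [] else []) ++ xs ++ ys) (redgeT≡marked false l) (redgeT≡marked true r)

swapRedge∘swapOdd : ∀ b T → swapRedge b (swapOdd b T) ≡ T
swapRedge∘swapOdd b     leaf         = refl
swapRedge∘swapOdd false (node l m r) =
  cong₂ (λ l′ r′ → node l′ m r′) (swapRedge∘swapOdd false l) (swapRedge∘swapOdd true r)
swapRedge∘swapOdd true  (node l m r) =
  cong₂ (λ l′ r′ → node l′ m r′) (swapRedge∘swapOdd true l) (swapRedge∘swapOdd false r)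

swapOdd∘swapRedge : ∀ b T → swapOdd b (swapRedge b T) ≡ T
swapOdd∘swapRedge b     leaf         = refl
swapOdd∘swapRedge false (node l m r) =
  cong₂ (λ l′ r′ → node l′ m r′) (swapOdd∘swapRedge false l) (swapOdd∘swapRedge true r)
swapOdd∘swapRedge true  (node l m r) =
  cong₂ (λ l′ r′ → node l′ m r′) (swapOdd∘swapRedge false l) (swapOdd∘swapRedge true r)

oddT↭redgeT-swapOdd : ∀ b T → oddT b T ↭ redgeT b (swapOdd b T)
oddT↭redgeT-swapOdd b     leaf         = ↭-refl
oddT↭redgeT-swapOdd false (node l m r) = ++⁺ (oddT↭redgeT-swapOdd false l) (oddT↭redgeT-swapOdd true r)
oddT↭redgeT-swapOdd true  (node l m r) =
  ↭-prep m (↭-trans (++⁺ (oddT↭redgeT-swapOdd true l) (oddT↭redgeT-swapOdd false r))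
                    (++-comm (redgeT true (swapOdd true l)) _))

redgeT↭oddT-swapRedge : ∀ b T → redgeT b T ↭ oddT b (swapRedge b T)
redgeT↭oddT-swapRedge b     leaf         = ↭-refl
redgeT↭oddT-swapRedge false (node l m r) = ++⁺ (redgeT↭oddT-swapRedge false l) (redgeT↭oddT-swapRedge true r)
redgeT↭oddT-swapRedge true  (node l m r) =
  ↭-prep m (↭-trans (++⁺ (redgeT↭oddT-swapRedge false l) (redgeT↭oddT-swapRedge true r))
                    (++-comm (oddT false (swapRedge false l)) _))

-- The decreasing binary tree of a word

maxL-ub : ∀ w → All (_≤ maxL w) w
maxL-ub []      = []
maxL-ub (a ∷ w) = m≤m⊔n a (maxL w) ∷ All.map (λ b≤ → ≤-trans b≤ (m≤n⊔m a (maxL w))) (maxL-ub w)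

maxL-least : ∀ {M} w → All (_≤ M) w → maxL w ≤ M
maxL-least []      _           = z≤n
maxL-least (a ∷ w) (a≤M ∷ w≤M) = ⊔-lub a≤M (maxL-least w w≤M)

maxL-∈ : ∀ a w → maxL (a ∷ w) ∈ a ∷ w
maxL-∈ a []      rewrite ⊔-identityʳ a = here refl
maxL-∈ a (b ∷ w) with ≤-total a (maxL (b ∷ w))
... | inj₁ a≤ rewrite m≤n⇒m⊔n≡n a≤ = there (maxL-∈ b w)
... | inj₂ ≤a rewrite m≥n⇒m⊔n≡m ≤a = here refl

maxL-≡ : ∀ {M} w → M ∈ w → All (_≤ M) w → maxL w ≡ M
maxL-≡ w M∈w w≤M = ≤-antisym (maxL-least w w≤M) (All.lookup (maxL-ub w) M∈w)

data MaxSplit : List ℕ → Set where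
  []    : MaxSplit []
  split : ∀ L M R → All (_< M) L → All (_< M) R → MaxSplit (L ++ M ∷ R)

maxSplit-at : ∀ {M} L R → Unique (L ++ M ∷ R) → All (_≤ M) (L ++ M ∷ R) → MaxSplit (L ++ M ∷ R)
maxSplit-at {M} L R u w≤M with _ , uMR , L#MR ← Unique-++⁻ {L} u =
  split L M R (All≤∧∉⇒All< (All.++⁻ˡ L w≤M) (λ M∈L → L#MR (M∈L , here refl)))
              (All≤∧∉⇒All< (All.++⁻ʳ (M ∷ []) (All.++⁻ʳ L w≤M)) (Unique.Unique[x∷xs]⇒x∉xs uMR))

maxSplit : ∀ {w} → Unique w → MaxSplit w
maxSplit {[]}    _ = []
maxSplit {a ∷ w} u with L , R , eq ← ∈-∃++ (maxL-∈ a w) =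
  subst MaxSplit (sym eq) (maxSplit-at L R (subst Unique eq u) (subst (All (_≤ maxL (a ∷ w))) eq (maxL-ub (a ∷ w))))

dbtF-suc : ∀ k w → w ≢ [] →
  dbtF (suc k) w ≡ node (dbtF k (proj₁ (splitOn (maxL w) w))) (maxL w) (dbtF k (proj₂ (splitOn (maxL w) w)))
dbtF-suc k []      w≢[] = ⊥-elim (w≢[] refl)
dbtF-suc k (_ ∷ _) _    = refl

dbtF-split : ∀ k L M R → All (_< M) L → All (_< M) R → dbtF (suc k) (L ++ M ∷ R) ≡ node (dbtF k L) M (dbtF k R)
dbtF-split k L M R L<M R<M
  rewrite dbtF-suc k (L ++ M ∷ R) (++-∷≢[] L)
        | maxL-≡ (L ++ M ∷ R) (∈-++⁺ʳ L (here refl)) (All.++⁺ (All.map <⇒≤ L<M) (≤-refl ∷ All.map <⇒≤ R<M))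
        | splitOn-++ L {R} (All<⇒∉ L<M)
        = refl

length-split : ∀ {k} (L : List ℕ) M R → length (L ++ M ∷ R) ≤ suc k → length L ≤ k × length R ≤ k
length-split {k} L M R len≤ with s≤s len≤′ ← subst (_≤ suc k) (length-++-sucʳ L M R) len≤ =
  ≤-trans (length-++-≤ˡ L) len≤′ , ≤-trans (length-++-≤ʳ R {L}) len≤′

dbtF-inorder : ∀ k {T} → Decreasing T → length (inorder T) ≤ k → dbtF k (inorder T) ≡ T
dbtF-inorder zero    leaf _ = refl
dbtF-inorder (suc k) leaf _ = refl
dbtF-inorder zero    {node l m r} _ len≤ with () ← subst (_≤ 0) (length-++-sucʳ (inorder l) m (inorder r)) len≤
dbtF-inorder (suc k) {node l m r} (node l<m r<m dl dr) len≤ =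
  trans (dbtF-split k (inorder l) m (inorder r) l<m r<m)
        (cong₂ (λ l′ r′ → node l′ m r′) (dbtF-inorder k dl (proj₁ lens)) (dbtF-inorder k dr (proj₂ lens)))
  where lens = length-split (inorder l) m (inorder r) len≤

dbt-inorder : ∀ {T} → Decreasing T → dbt (inorder T) ≡ T
dbt-inorder d = dbtF-inorder _ d ≤-refl

inorder-dbtF : ∀ k {w} → Unique w → length w ≤ k → inorder (dbtF k w) ≡ w × Decreasing (dbtF k w)
inorder-dbtF k u len≤ with maxSplit u
inorder-dbtF zero    u len≤ | []               = refl , leaf
inorder-dbtF (suc k) u len≤ | []               = refl , leaf
inorder-dbtF zero    u len≤ | split L M R _ _  with () ← subst (_≤ 0) (length-++-sucʳ L M R) len≤
inorder-dbtF (suc k) u len≤ | split L M R L<M R<M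
  with uL , _ ∷ uR , _ ← Unique-++⁻ {L} u
  with eqL , dL ← inorder-dbtF k uL (proj₁ (length-split L M R len≤))
  with eqR , dR ← inorder-dbtF k uR (proj₂ (length-split L M R len≤))
  rewrite dbtF-split k L M R L<M R<M =
  cong₂ (λ L′ R′ → L′ ++ M ∷ R′) eqL eqR ,
  node (subst (All (_< M)) (sym eqL) L<M) (subst (All (_< M)) (sym eqR) R<M) dL dR

inorder-surjective : ∀ {w} → Unique w → ∃[ T ] DecreasingDistinct T × inorder T ≡ w
inorder-surjective {w} u with eq , d ← inorder-dbtF (length w) u ≤-refl =
  dbt w , (d , subst Unique (sym eq) u) , eq

-- Ψ and Φ on permutations

Odd-inorder : ∀ {T} → Decreasing T → Odd (inorder T) ≡ oddT false T
Odd-inorder d = cong (oddT false) (dbt-inorder d)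

Redge-inorder : ∀ {T} → Decreasing T → Redge (inorder T) ≡ redgeT false T
Redge-inorder d = cong (redgeT false) (dbt-inorder d)

Ψ-inorder : ∀ {T} → DecreasingDistinct T → Ψ (inorder T) ≡ inorder (swapOdd false T)
Ψ-inorder {T} dd@(d , _) = begin
  φs (Odd (inorder T)) (inorder T)               ≡⟨ cong (λ xs → φs xs (inorder T)) (Odd-inorder d) ⟩
  φs (oddT false T) (inorder T)                  ≡⟨ cong (λ xs → φs xs (inorder T)) (oddT≡marked false T) ⟩
  φs (OddVertices.marked false T) (inorder T)    ≡⟨ OddVertices.φs-marked false dd ⟩
  inorder (swapOdd false T)                      ∎
  where open ≡-Reasoning

Φ-inorder : ∀ {T} → DecreasingDistinct T → Φ (inorder T) ≡ inorder (swapRedge false T)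
Φ-inorder {T} dd@(d , _) = begin
  φs (Redge (inorder T)) (inorder T)             ≡⟨ cong (λ xs → φs xs (inorder T)) (Redge-inorder d) ⟩
  φs (redgeT false T) (inorder T)                ≡⟨ cong (λ xs → φs xs (inorder T)) (redgeT≡marked false T) ⟩
  φs (RightChildren.marked false T) (inorder T)  ≡⟨ RightChildren.φs-marked false dd ⟩
  inorder (swapRedge false T)                    ∎
  where open ≡-Reasoning

Ψ-↭ : ∀ {π} → Unique π → Ψ π ↭ π
Ψ-↭ u with T , dd , refl ← inorder-surjective u =
  ↭-trans (↭-reflexive (Ψ-inorder dd)) (OddVertices.inorder-swapMarked false dd)

Φ-↭ : ∀ {π} → Unique π → Φ π ↭ π
Φ-↭ u with T , dd , refl ← inorder-surjective u =
  ↭-trans (↭-reflexive (Φ-inorder dd)) (RightChildren.inorder-swapMarked false dd)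

Φ∘Ψ : ∀ {π} → Unique π → Φ (Ψ π) ≡ π
Φ∘Ψ u with T , dd , refl ← inorder-surjective u = begin
  Φ (Ψ (inorder T))                            ≡⟨ cong Φ (Ψ-inorder dd) ⟩
  Φ (inorder (swapOdd false T))                ≡⟨ Φ-inorder (OddVertices.DecreasingDistinct-swapMarked false dd) ⟩
  inorder (swapRedge false (swapOdd false T))  ≡⟨ cong inorder (swapRedge∘swapOdd false T) ⟩
  inorder T                                    ∎
  where open ≡-Reasoning

Ψ∘Φ : ∀ {π} → Unique π → Ψ (Φ π) ≡ π
Ψ∘Φ u with T , dd , refl ← inorder-surjective u = begin
  Ψ (Φ (inorder T))                            ≡⟨ cong Ψ (Φ-inorder dd) ⟩
  Ψ (inorder (swapRedge false T))              ≡⟨ Ψ-inorder (RightChildren.DecreasingDistinct-swapMarked false dd) ⟩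
  inorder (swapOdd false (swapRedge false T))  ≡⟨ cong inorder (swapOdd∘swapRedge false T) ⟩
  inorder T                                    ∎
  where open ≡-Reasoning

Odd↭Redge∘Ψ : ∀ {π} → Unique π → Odd π ↭ Redge (Ψ π)
Odd↭Redge∘Ψ u with T , dd@(d , _) , refl ← inorder-surjective u = begin
  Odd (inorder T)                        ≡⟨ Odd-inorder d ⟩
  oddT false T                           ↭⟨ oddT↭redgeT-swapOdd false T ⟩
  redgeT false (swapOdd false T)         ≡⟨ Redge-inorder (proj₁ (OddVertices.DecreasingDistinct-swapMarked false dd)) ⟨
  Redge (inorder (swapOdd false T))      ≡⟨ cong Redge (Ψ-inorder dd) ⟨
  Redge (Ψ (inorder T))                  ∎
  where open PermutationReasoning

Redge↭Odd∘Φ : ∀ {π} → Unique π → Redge π ↭ Odd (Φ π)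
Redge↭Odd∘Φ u with T , dd@(d , _) , refl ← inorder-surjective u = begin
  Redge (inorder T)                      ≡⟨ Redge-inorder d ⟩
  redgeT false T                         ↭⟨ redgeT↭oddT-swapRedge false T ⟩
  oddT false (swapRedge false T)         ≡⟨ Odd-inorder (proj₁ (RightChildren.DecreasingDistinct-swapMarked false dd)) ⟨
  Odd (inorder (swapRedge false T))      ≡⟨ cong Odd (Φ-inorder dd) ⟨
  Odd (Φ (inorder T))                    ∎
  where open PermutationReasoning

theorem7p1 : (n : ℕ) →
    ((π : List ℕ) → π ↭ oneTo n →
      (Ψ π ↭ oneTo n) × (Φ π ↭ oneTo n) × (Φ (Ψ π) ≡ π) × (Ψ (Φ π) ≡ π)) ×
    ((π : List ℕ) → π ↭ oneTo n →
      ((x : ℕ) → (x ∈ Odd π) ⇔ (x ∈ Redge (Ψ π))) ×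
      ((x : ℕ) → (x ∈ Redge π) ⇔ (x ∈ Odd (Φ π))))
theorem7p1 n =
    (λ π π↭ → let u = unique π↭ in ↭-trans (Ψ-↭ u) π↭ , ↭-trans (Φ-↭ u) π↭ , Φ∘Ψ u , Ψ∘Φ u)
  , (λ π π↭ → let u = unique π↭ in ↭⇒∈⇔ (Odd↭Redge∘Ψ u) , ↭⇒∈⇔ (Redge↭Odd∘Φ u))
  where
  unique : ∀ {π} → π ↭ oneTo n → Unique π
  unique π↭ = Unique-resp-↭ (↭⇒↭ₛ (↭-sym π↭)) (Unique.map⁺ suc-injective (Unique.upTo⁺ n))
  ↭⇒∈⇔ : ∀ {xs ys : List ℕ} → xs ↭ ys → (x : ℕ) → (x ∈ xs) ⇔ (x ∈ ys)
  ↭⇒∈⇔ p x = mk⇔ (∈-resp-↭ p) (∈-resp-↭ (↭-sym p))
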